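{- Let $q$ be a power of two, $A$ a $q$-modular witness in a graph $G$, $d$ a lift modulo $2q$ of the common residue modulo $q$ of the degrees $\deg_A(v)$, and $b_A:A\to\mathbb F_2$ defined by $\deg_A(v)\equiv d+qb_A(v)\pmod{2q}$. Let $U\subseteq A$ and suppose $D=A\setminus U$ is partitioned into blocks $P_1,\dots,P_t$, each of size $q$, all vertices of $P_i$ having the same trace $B_i=N(x)\cap U$ on $U$. For $I\subseteq\{1,\dots,t\}$ put $E_I=\bigcup_{i\in I}P_i$ and $W_I=A\setminus E_I$. Then the degrees $\deg_{W_I}(u)$, $u\in U$, are all congruent modulo $2q$ if and only if $[b_A|_U]=\sum_{i\in I}[\mathbf 1_{B_i}]$ in $\mathbb F_2^U/\langle\mathbf 1_U\rangle$. Consequently, some subcollection $I$ achieves this if and only if $[b_A|_U]\in\operatorname{Span}\{[\mathbf 1_{B_1}],\dots,[\mathbf 1_{B_t}]\}$. For $I=\{1,\dots,t\}$ (so $W_I=U$), $U$ is $2q$-modular if and only if $[b_A|_U]=\sum_{i=1}^t[\mathbf 1_{B_i}]$.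
   Context: Graphs are finite simple; $\deg_S(v)$ is the degree of $v$ in $G[S]$; $S$ is $q$-modular if all $\deg_S(v)$, $v\in S$, are congruent modulo $q$. $\mathbf 1_B\in\mathbb F_2^U$ is the indicator of $B$; quotient by constants. -}

module Defs where

open import Data.Bool using (Bool; true; false; _∧_; _xor_; if_then_else_)
open import Data.Nat using (ℕ; _*_; _^_)
open import Data.Integer as ℤ using (ℤ; +_)
open import Data.Integer.Divisibility as ℤ∣ using ()
open import Data.Fin using (Fin)
open import Data.Fin.Subset using (Subset; _∈_; _∩_; ∣_∣)
open import Data.Vec using (tabulate; lookup)
open import Data.List using (List; foldr; map)
open import Data.Bool.ListAction using (any)
open import Data.List using () renaming (allFin to allFinL)
open import Data.Product using (∃; _×_)
open import Relation.Binary.PropositionalEquality using (_≡_)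

record Graph (n : ℕ) : Set where
  field
    adj   : Fin n → Fin n → Bool
    sym   : ∀ x y → adj x y ≡ adj y x
    irref : ∀ x → adj x x ≡ false
open Graph public

N : ∀ {n} → Graph n → Fin n → Subset n
N G v = tabulate (adj G v)

-- deg_S(v) : degree of v in G[S]  (= |N(v) ∩ S|, irreflexivity excludes v)
deg : ∀ {n} → Graph n → Subset n → Fin n → ℕ
deg G S v = ∣ N G v ∩ S ∣

_≡_[mod_] : ℕ → ℕ → ℕ → Set
a ≡ b [mod m ] = (+ m) ℤ∣.∣ ((+ a) ℤ.- (+ b))

Modular : ∀ {n} → Graph n → ℕ → Subset n → Set
Modular G q S = ∀ u v → u ∈ S → v ∈ S → deg G S u ≡ deg G S v [mod q ]

IsPowerOfTwo : ℕ → Set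
IsPowerOfTwo q = ∃ λ k → q ≡ 2 ^ k

unionOver : ∀ {n t} → Subset t → (Fin t → Subset n) → Subset n
unionOver {t = t} I P =
  tabulate (λ x → any (λ i → lookup I i ∧ lookup (P i) x) (allFinL t))

sumInd : ∀ {n t} → Subset t → (Fin t → Subset n) → Fin n → Bool
sumInd {t = t} I B u =
  foldr _xor_ false (map (λ i → lookup I i ∧ lookup (B i) u) (allFinL t))

-- equality of [f|_U] and [g|_U] in 𝔽₂^U / ⟨1_U⟩ : f + g is constant on U
EqModConst : ∀ {n} → Subset n → (Fin n → Bool) → (Fin n → Bool) → Set
EqModConst U f g = ∃ λ c → ∀ u → u ∈ U → (f u xor g u) ≡ c

InSpanModConst : ∀ {n t} → Subset n → (Fin n → Bool) → (Fin t → Subset n) → Set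
InSpanModConst {t = t} U f B = ∃ λ (λs : Subset t) → EqModConst U f (sumInd λs B)

toℕ𝔹 : Bool → ℕ
toℕ𝔹 b = if b then 1 else 0

-- For u ∈ U every block P_i lies in A ─ U, has q vertices, and is adjacent to u either
-- entirely (u ∈ B_i) or not at all, so deg_A(u) = deg_{W_I}(u) + q·#{i ∈ I | u ∈ B_i}.
-- The count is ≡ Σ_{i∈I} 1_{B_i}(u) mod 2, hence
--   deg_{W_I}(u) ≡ d + q·(b_A + Σ_{i∈I} 1_{B_i})(u)  (mod 2q),
-- and two residues d + q·x, d + q·y with bits x, y agree mod 2q iff x = y.  So the degrees
-- on U are congruent mod 2q iff b_A + Σ_{i∈I} 1_{B_i} is constant on U.  For I = ⊤ the
-- blocks exhaust A ─ U, so W_⊤ = U.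

module Submission where

open import Defs
open import Data.Bool using (Bool; true; false)
open import Data.Nat using (ℕ; _+_; _*_)
open import Data.Fin using (Fin)
open import Data.Fin.Subset using (Subset; _∈_; _⊆_; _─_; _∩_; ⊥; ⊤; ∣_∣)
open import Data.Vec using (lookup)
open import Data.Product using (∃; _×_; _,_)
open import Function.Bundles using (_⇔_)
open import Relation.Binary.PropositionalEquality using (_≡_; _≢_)

open import Data.Bool using (not; _∧_; _∨_; _xor_)
import Data.Bool.Properties as Bool
open import Data.Nat using (suc; zero; NonZero; _≤_; _<_)
import Data.Nat.Properties as ℕ
open import Data.Nat.Divisibility as ℕ∣ using (∣⇒≤)
open import Data.Integer as ℤ using (ℤ; +_)
  renaming (_+_ to _+ᶻ_; _*_ to _*ᶻ_; _-_ to _-ᶻ_)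
import Data.Integer.Properties as ℤ
open import Data.Integer.Divisibility.Signed
  using (∣ᵤ⇒∣; ∣⇒∣ᵤ; ∣-refl; ∣m∣n⇒∣m+n; ∣m⇒∣m*n) renaming (_∣_ to _∣ˢ_)
open import Data.Integer.Tactic.RingSolver using (solve-∀)
open import Data.Fin using (zero; suc)
import Data.Fin.Properties as Fin
open import Data.Fin.Subset.Properties using (p─q⊆p; drop-∷-⊆; ⊆-antisym; ∈⊤; nonempty?)
open import Data.Vec using (_∷_; []; here)
import Data.Vec.Properties as Vec
open import Data.Vec.Functional using (foldr)
import Data.List.Base as List
import Data.List.Properties as List
open import Data.Product using (proj₂)
open import Data.Empty using (⊥-elim)
open import Algebra.Properties.Semiring.Sum ℕ.+-*-semiring
  using (sum-cong-≗; sum-replicate-zero; ∑-distrib-+; ∑-comm; *-distribˡ-sum; sum-syntax)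
open import Algebra.Properties.CommutativeSemigroup ℕ.*-commutativeSemigroup using (x∙yz≈y∙xz)
open import Function.Base using (id; _∘_)
open import Function.Bundles using (mk⇔; module Equivalence)
open import Relation.Nullary using (¬_; contradiction; yes; no)
open import Relation.Binary.PropositionalEquality
  using (refl; trans; cong; cong₂; subst; module ≡-Reasoning)
import Relation.Binary.PropositionalEquality as ≡

foldr-map-allFin : ∀ {A B : Set} (f : A → B → B) (z : B) {t} (g : Fin t → A) →
  List.foldr f z (List.map g (List.allFin t)) ≡ foldr f z g
foldr-map-allFin {A} f z g = trans (cong (List.foldr f z) (List.map-tabulate id g)) (foldr-tabulate g)
  where
  foldr-tabulate : ∀ {t} (g : Fin t → A) → List.foldr f z (List.tabulate g) ≡ foldr f z g
  foldr-tabulate {zero}  g = refl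
  foldr-tabulate {suc t} g = cong (f (g zero)) (foldr-tabulate (g ∘ suc))

∧≡true⇔ : ∀ {a b} → a ∧ b ≡ true ⇔ (a ≡ true × b ≡ true)
∧≡true⇔ {true}  = mk⇔ (refl ,_) proj₂
∧≡true⇔ {false} = mk⇔ (λ ()) (λ ())

foldr-∨≡true⇔ : ∀ {t} (g : Fin t → Bool) → foldr _∨_ false g ≡ true ⇔ ∃ λ i → g i ≡ true
foldr-∨≡true⇔ {zero}  g = mk⇔ (λ ()) (λ ())
foldr-∨≡true⇔ {suc t} g with g zero in g₀
... | true  = mk⇔ (λ _ → zero , g₀) (λ _ → refl)
... | false = mk⇔
  (λ h → let i , gᵢ = Equivalence.to (foldr-∨≡true⇔ (g ∘ suc)) h in suc i , gᵢ)
  (λ { (zero , g₀′) → contradiction (trans (≡.sym g₀′) g₀) λ ()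
     ; (suc i , gᵢ) → Equivalence.from (foldr-∨≡true⇔ (g ∘ suc)) (i , gᵢ) })

toℕ𝔹-∧ : ∀ a b → toℕ𝔹 (a ∧ b) ≡ toℕ𝔹 a * toℕ𝔹 b
toℕ𝔹-∧ false b = refl
toℕ𝔹-∧ true  b = ≡.sym (ℕ.*-identityˡ (toℕ𝔹 b))

toℕ𝔹-∨-disjoint : ∀ {t} (g : Fin t → Bool) → (∀ {i j} → i ≢ j → g i ≡ true → g j ≢ true) →
  toℕ𝔹 (foldr _∨_ false g) ≡ ∑[ i < t ] toℕ𝔹 (g i)
toℕ𝔹-∨-disjoint {zero}  g disjoint = refl
toℕ𝔹-∨-disjoint {suc t} g disjoint with g zero in g₀
... | true  = cong suc (≡.sym (trans (sum-cong-≗ others) (sum-replicate-zero t)))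
  where
  others : ∀ i → toℕ𝔹 (g (suc i)) ≡ 0
  others i with g (suc i) in gᵢ
  ... | false = refl
  ... | true  = contradiction gᵢ (disjoint (λ ()) g₀)
... | false = toℕ𝔹-∨-disjoint (g ∘ suc) (λ i≢j → disjoint (i≢j ∘ Fin.suc-injective))

∑-toℕ𝔹-parity : ∀ {t} (g : Fin t → Bool) →
  ∃ λ k → ∑[ i < t ] toℕ𝔹 (g i) ≡ toℕ𝔹 (foldr _xor_ false g) + 2 * k
∑-toℕ𝔹-parity {zero}  g = 0 , refl
∑-toℕ𝔹-parity {suc t} g with ∑-toℕ𝔹-parity (g ∘ suc)
... | k , ∑≡ with g zero | foldr _xor_ false (g ∘ suc)
...   | false | _     = k , ∑≡
...   | true  | false = k , cong suc ∑≡
...   | true  | true  = suc k , cong suc (trans ∑≡ (≡.sym (ℕ.+-suc k (k + 0))))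

sumInd-parity : ∀ {n t} (I : Subset t) (B : Fin t → Subset n) u →
  ∃ λ k → ∑[ i < t ] toℕ𝔹 (lookup I i ∧ lookup (B i) u) ≡ toℕ𝔹 (sumInd I B u) + 2 * k
sumInd-parity {t = t} I B u =
  subst (λ s → ∃ λ k → ∑[ i < t ] toℕ𝔹 (g i) ≡ toℕ𝔹 s + 2 * k)
        (≡.sym (foldr-map-allFin _xor_ false g)) (∑-toℕ𝔹-parity g)
  where
  g : Fin t → Bool
  g i = lookup I i ∧ lookup (B i) u

χ : ∀ {n} → Subset n → Fin n → ℕ
χ p x = toℕ𝔹 (lookup p x)

∣p∣≡∑χ : ∀ {n} (p : Subset n) → ∣ p ∣ ≡ ∑[ x < n ] χ p x
∣p∣≡∑χ []          = refl
∣p∣≡∑χ (true  ∷ p) = cong suc (∣p∣≡∑χ p)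
∣p∣≡∑χ (false ∷ p) = ∣p∣≡∑χ p

χ-∩ : ∀ {n} (p q : Subset n) x → χ (p ∩ q) x ≡ χ p x * χ q x
χ-∩ p q x = trans (cong toℕ𝔹 (Vec.lookup-zipWith _∧_ x p q)) (toℕ𝔹-∧ (lookup p x) (lookup q x))

lookup-─ : ∀ {n} (p q : Subset n) x → lookup (p ─ q) x ≡ lookup p x ∧ not (lookup q x)
lookup-─ (a ∷ p) (true  ∷ q) zero    = ≡.sym (Bool.∧-zeroʳ a)
lookup-─ (a ∷ p) (false ∷ q) zero    = ≡.sym (Bool.∧-identityʳ a)
lookup-─ (_ ∷ p) (_     ∷ q) (suc x) = lookup-─ p q x

χ-─ : ∀ {n} {p q : Subset n} → q ⊆ p → ∀ x → χ p x ≡ χ (p ─ q) x + χ q x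
χ-─ {p = p} {q} q⊆p x rewrite lookup-─ p q x with lookup q x in qx | lookup p x in px
... | false | false = refl
... | false | true  = refl
... | true  | true  = refl
... | true  | false =
  contradiction (trans (≡.sym px) (Vec.[]=⇒lookup (q⊆p (Vec.lookup⇒[]= x q qx)))) λ ()

p─[p─q]≡q : ∀ {n} {p q : Subset n} → q ⊆ p → p ─ (p ─ q) ≡ q
p─[p─q]≡q {p = []}        {[]}        _   = refl
p─[p─q]≡q {p = true  ∷ p} {true  ∷ q} q⊆p = cong (true ∷_) (p─[p─q]≡q (drop-∷-⊆ q⊆p))
p─[p─q]≡q {p = true  ∷ p} {false ∷ q} q⊆p = cong (false ∷_) (p─[p─q]≡q (drop-∷-⊆ q⊆p))
p─[p─q]≡q {p = false ∷ p} {false ∷ q} q⊆p = cong (false ∷_) (p─[p─q]≡q (drop-∷-⊆ q⊆p))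
p─[p─q]≡q {p = false ∷ p} {true  ∷ q} q⊆p with q⊆p here
... | ()

pairwise⇔constantOn : ∀ {n} {R : Fin n → Fin n → Set} (U : Subset n) {f : Fin n → Bool} →
  (∀ {u v} → u ∈ U → v ∈ U → R u v ⇔ (f u ≡ f v)) →
  (∀ u v → u ∈ U → v ∈ U → R u v) ⇔ (∃ λ c → ∀ u → u ∈ U → f u ≡ c)
pairwise⇔constantOn {R = R} U {f} R⇔f≡f = mk⇔ constant pairwise
  where
  constant : (∀ u v → u ∈ U → v ∈ U → R u v) → ∃ λ c → ∀ u → u ∈ U → f u ≡ c
  constant R-all with nonempty? U
  ... | yes (v , v∈U) = f v , λ u u∈U → Equivalence.to (R⇔f≡f u∈U v∈U) (R-all u v u∈U v∈U)
  ... | no  U-empty   = false , λ u u∈U → contradiction (u , u∈U) U-empty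
  pairwise : (∃ λ c → ∀ u → u ∈ U → f u ≡ c) → ∀ u v → u ∈ U → v ∈ U → R u v
  pairwise (c , f≡c) u v u∈U v∈U =
    Equivalence.from (R⇔f≡f u∈U v∈U) (trans (f≡c u u∈U) (≡.sym (f≡c v v∈U)))

lookup-unionOver : ∀ {n t} (I : Subset t) (P : Fin t → Subset n) x →
  lookup (unionOver I P) x ≡ foldr _∨_ false (λ i → lookup I i ∧ lookup (P i) x)
lookup-unionOver I P x =
  trans (Vec.lookup∘tabulate _ x) (foldr-map-allFin _∨_ false (λ i → lookup I i ∧ lookup (P i) x))

∈-unionOver : ∀ {n t} {I : Subset t} {P : Fin t → Subset n} {x} →
  x ∈ unionOver I P ⇔ ∃ λ i → i ∈ I × x ∈ P i
∈-unionOver {I = I} {P} {x} = mk⇔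
  (λ x∈E → let i , Iᵢ∧Pᵢx = Equivalence.to (foldr-∨≡true⇔ g)
                                 (trans (≡.sym (lookup-unionOver I P x)) (Vec.[]=⇒lookup x∈E))
               Iᵢ , Pᵢx = Equivalence.to (∧≡true⇔ {lookup I i}) Iᵢ∧Pᵢx
           in i , Vec.lookup⇒[]= i I Iᵢ , Vec.lookup⇒[]= x (P i) Pᵢx)
  (λ (i , i∈I , x∈Pᵢ) → Vec.lookup⇒[]= x (unionOver I P) (trans (lookup-unionOver I P x)
     (Equivalence.from (foldr-∨≡true⇔ g)
        (i , Equivalence.from (∧≡true⇔ {lookup I i}) (Vec.[]=⇒lookup i∈I , Vec.[]=⇒lookup x∈Pᵢ)))))
  where
  g : Fin _ → Bool
  g i = lookup I i ∧ lookup (P i) x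

χ-unionOver : ∀ {n t} {P : Fin t → Subset n} → (∀ i j → i ≢ j → P i ∩ P j ≡ ⊥) →
  ∀ I x → χ (unionOver I P) x ≡ ∑[ i < t ] (χ I i * χ (P i) x)
χ-unionOver {t = t} {P} disjoint I x = begin
  χ (unionOver I P) x
    ≡⟨ cong toℕ𝔹 (lookup-unionOver I P x) ⟩
  toℕ𝔹 (foldr _∨_ false (λ i → lookup I i ∧ lookup (P i) x))
    ≡⟨ toℕ𝔹-∨-disjoint (λ i → lookup I i ∧ lookup (P i) x) at-most-one ⟩
  ∑[ i < t ] toℕ𝔹 (lookup I i ∧ lookup (P i) x)
    ≡⟨ sum-cong-≗ (λ i → toℕ𝔹-∧ (lookup I i) (lookup (P i) x)) ⟩
  ∑[ i < t ] (χ I i * χ (P i) x) ∎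
  where
  open ≡-Reasoning
  at-most-one : ∀ {i j} → i ≢ j →
    lookup I i ∧ lookup (P i) x ≡ true → lookup I j ∧ lookup (P j) x ≢ true
  at-most-one {i} {j} i≢j Iᵢ∧Pᵢx Iⱼ∧Pⱼx = contradiction (begin
    true                            ≡⟨ cong₂ _∧_ (proj₂ (Equivalence.to (∧≡true⇔ {lookup I i}) Iᵢ∧Pᵢx))
                                                 (proj₂ (Equivalence.to (∧≡true⇔ {lookup I j}) Iⱼ∧Pⱼx)) ⟨
    lookup (P i) x ∧ lookup (P j) x ≡⟨ Vec.lookup-zipWith _∧_ x (P i) (P j) ⟨
    lookup (P i ∩ P j) x            ≡⟨ cong (λ S → lookup S x) (disjoint i j i≢j) ⟩
    lookup ⊥ x                      ≡⟨ Vec.lookup-replicate x false ⟩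
    false                           ∎) λ ()

module _ {n} (G : Graph n) where
  open ≡-Reasoning

  deg≡∑ : ∀ S u → deg G S u ≡ ∑[ x < n ] (toℕ𝔹 (adj G u x) * χ S x)
  deg≡∑ S u = trans (∣p∣≡∑χ (N G u ∩ S)) (sum-cong-≗ λ x →
    trans (χ-∩ (N G u) S x) (cong (λ a → toℕ𝔹 a * χ S x) (Vec.lookup∘tabulate (adj G u) x)))

  deg-split : ∀ {S T} → T ⊆ S → ∀ u → deg G S u ≡ deg G (S ─ T) u + deg G T u
  deg-split {S} {T} T⊆S u = begin
    deg G S u
      ≡⟨ deg≡∑ S u ⟩
    ∑[ x < n ] (a x * χ S x)
      ≡⟨ sum-cong-≗ (λ x → trans (cong (a x *_) (χ-─ T⊆S x)) (ℕ.*-distribˡ-+ (a x) _ _)) ⟩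
    ∑[ x < n ] (a x * χ (S ─ T) x + a x * χ T x)
      ≡⟨ ∑-distrib-+ (λ x → a x * χ (S ─ T) x) (λ x → a x * χ T x) ⟩
    ∑[ x < n ] (a x * χ (S ─ T) x) + ∑[ x < n ] (a x * χ T x)
      ≡⟨ cong₂ _+_ (deg≡∑ (S ─ T) u) (deg≡∑ T u) ⟨
    deg G (S ─ T) u + deg G T u ∎
    where
    a : Fin n → ℕ
    a x = toℕ𝔹 (adj G u x)

  deg-unionOver : ∀ {t} {P : Fin t → Subset n} → (∀ i j → i ≢ j → P i ∩ P j ≡ ⊥) →
    ∀ I u → deg G (unionOver I P) u ≡ ∑[ i < t ] (χ I i * deg G (P i) u)
  deg-unionOver {t} {P} disjoint I u = begin
    deg G (unionOver I P) u
      ≡⟨ deg≡∑ (unionOver I P) u ⟩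
    ∑[ x < n ] (a x * χ (unionOver I P) x)
      ≡⟨ sum-cong-≗ (λ x → trans (cong (a x *_) (χ-unionOver disjoint I x))
                                 (*-distribˡ-sum (a x) (λ i → χ I i * χ (P i) x))) ⟩
    ∑[ x < n ] ∑[ i < t ] (a x * (χ I i * χ (P i) x))
      ≡⟨ sum-cong-≗ (λ x → sum-cong-≗ (λ i → x∙yz≈y∙xz (a x) (χ I i) (χ (P i) x))) ⟩
    ∑[ x < n ] ∑[ i < t ] (χ I i * (a x * χ (P i) x))
      ≡⟨ ∑-comm (λ x i → χ I i * (a x * χ (P i) x)) ⟩
    ∑[ i < t ] ∑[ x < n ] (χ I i * (a x * χ (P i) x))
      ≡⟨ sum-cong-≗ (λ i → *-distribˡ-sum (χ I i) (λ x → a x * χ (P i) x)) ⟨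
    ∑[ i < t ] (χ I i * ∑[ x < n ] (a x * χ (P i) x))
      ≡⟨ sum-cong-≗ (λ i → cong (χ I i *_) (deg≡∑ (P i) u)) ⟨
    ∑[ i < t ] (χ I i * deg G (P i) u) ∎
    where
    a : Fin n → ℕ
    a x = toℕ𝔹 (adj G u x)

  deg-homogeneous : ∀ {S q u c} → ∣ S ∣ ≡ q → (∀ x → x ∈ S → adj G u x ≡ c) →
    deg G S u ≡ toℕ𝔹 c * q
  deg-homogeneous {S} {q} {u} {c} ∣S∣≡q adj≡c = begin
    deg G S u                             ≡⟨ deg≡∑ S u ⟩
    ∑[ x < n ] (toℕ𝔹 (adj G u x) * χ S x) ≡⟨ sum-cong-≗ adj≡c-on-S ⟩
    ∑[ x < n ] (toℕ𝔹 c * χ S x)           ≡⟨ *-distribˡ-sum (toℕ𝔹 c) (χ S) ⟨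
    toℕ𝔹 c * ∑[ x < n ] χ S x             ≡⟨ cong (toℕ𝔹 c *_) (trans (≡.sym (∣p∣≡∑χ S)) ∣S∣≡q) ⟩
    toℕ𝔹 c * q                            ∎
    where
    adj≡c-on-S : ∀ x → toℕ𝔹 (adj G u x) * χ S x ≡ toℕ𝔹 c * χ S x
    adj≡c-on-S x with lookup S x in Sx
    ... | false = trans (ℕ.*-zeroʳ (toℕ𝔹 (adj G u x))) (≡.sym (ℕ.*-zeroʳ (toℕ𝔹 c)))
    ... | true  = cong (λ b → toℕ𝔹 b * 1) (adj≡c x (Vec.lookup⇒[]= x S Sx))

pos-+-* : ∀ a b c → + (a + b * c) ≡ + a +ᶻ + b *ᶻ + c
pos-+-* a b c = trans (ℤ.pos-+ a (b * c)) (cong (+ a +ᶻ_) (ℤ.pos-* b c))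

≡[mod]-sym : ∀ {a b m} → a ≡ b [mod m ] → b ≡ a [mod m ]
≡[mod]-sym {a} {b} m∣a-b = subst (_ ℕ∣.∣_) (ℤ.∣i-j∣≡∣j-i∣ (+ a) (+ b)) m∣a-b

≡[mod]-trans : ∀ {a b c m} → a ≡ b [mod m ] → b ≡ c [mod m ] → a ≡ c [mod m ]
≡[mod]-trans {a} {b} {c} {m} m∣a-b m∣b-c = ∣⇒∣ᵤ (subst (+ m ∣ˢ_) (telescope (+ a) (+ b) (+ c))
  (∣m∣n⇒∣m+n (∣ᵤ⇒∣ {+ m} {+ a -ᶻ + b} m∣a-b) (∣ᵤ⇒∣ {+ m} {+ b -ᶻ + c} m∣b-c)))
  where
  telescope : ∀ a b c → (a -ᶻ b) +ᶻ (b -ᶻ c) ≡ a -ᶻ c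
  telescope = solve-∀

bit-residue-injective : ∀ {q d} .{{_ : NonZero q}} {x y} →
  (d + q * toℕ𝔹 x) ≡ d + q * toℕ𝔹 y [mod 2 * q ] → x ≡ y
bit-residue-injective {x = false} {false} _ = refl
bit-residue-injective {x = true}  {true}  _ = refl
bit-residue-injective {q} {d} {x = true} {false} 2q∣q =
  ⊥-elim (2q≰q (∣⇒≤ (subst (_ ℕ∣.∣_) diff≡q 2q∣q)))
  where
  diff≡q : ℤ.∣ + (d + q * 1) -ᶻ + (d + q * 0) ∣ ≡ q
  diff≡q = cong ℤ.∣_∣ (trans (cong₂ _-ᶻ_ (pos-+-* d q 1) (pos-+-* d q 0)) (cancel (+ d) (+ q)))
    where
    cancel : ∀ D Q → (D +ᶻ Q *ᶻ + 1) -ᶻ (D +ᶻ Q *ᶻ + 0) ≡ Q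
    cancel = solve-∀
  2q≰q : ¬ (2 * q ≤ q)
  2q≰q = ℕ.<⇒≱ (subst (q <_) (ℕ.*-comm q 2) (ℕ.m<m*n q 2 (ℕ.n<1+n 1)))
bit-residue-injective {q} {d} {x = false} {true} 2q∣-q =
  ≡.sym (bit-residue-injective {q} {d} (≡[mod]-sym {d + q * 0} 2q∣-q))

-- The carry b ∧ s of the bit sum b + s = (b xor s) + 2 (b ∧ s) is absorbed by the modulus 2q.
residue-xor : ∀ {q d w b s} k →
  (w + q * (toℕ𝔹 s + 2 * k)) ≡ d + q * toℕ𝔹 b [mod 2 * q ] →
  w ≡ d + q * toℕ𝔹 (b xor s) [mod 2 * q ]
residue-xor {q} {d} {w} {b} {s} k 2q∣h = ∣⇒∣ᵤ (subst (+ (2 * q) ∣ˢ_) (≡.sym difference)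
  (∣m∣n⇒∣m+n (∣ᵤ⇒∣ {+ (2 * q)} {hypDiff} 2q∣h) (∣m⇒∣m*n (C -ᶻ S -ᶻ K) (∣-refl {+ (2 * q)}))))
  where
  bit : Bool → ℤ
  bit x = + toℕ𝔹 x
  W D Q K S X C hypDiff : ℤ
  W = + w ; D = + d ; Q = + q ; K = + k
  S = bit s ; X = bit (b xor s) ; C = bit (b ∧ s)
  hypDiff = + (w + q * (toℕ𝔹 s + 2 * k)) -ᶻ + (d + q * toℕ𝔹 b)

  carry : ∀ b s → bit b ≡ (bit (b xor s) +ᶻ + 2 *ᶻ bit (b ∧ s)) -ᶻ bit s
  carry false false = refl
  carry false true  = refl
  carry true  false = refl
  carry true  true  = refl

  identity : ∀ W D Q X C S K → W -ᶻ (D +ᶻ Q *ᶻ X) ≡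
    ((W +ᶻ Q *ᶻ (S +ᶻ + 2 *ᶻ K)) -ᶻ (D +ᶻ Q *ᶻ ((X +ᶻ + 2 *ᶻ C) -ᶻ S)))
      +ᶻ (+ 2 *ᶻ Q) *ᶻ (C -ᶻ S -ᶻ K)
  identity = solve-∀

  hypDiff≡ : hypDiff ≡ (W +ᶻ Q *ᶻ (S +ᶻ + 2 *ᶻ K)) -ᶻ (D +ᶻ Q *ᶻ ((X +ᶻ + 2 *ᶻ C) -ᶻ S))
  hypDiff≡ = cong₂ _-ᶻ_
    (trans (pos-+-* w q _) (cong (λ z → W +ᶻ Q *ᶻ z) (pos-+-* (toℕ𝔹 s) 2 k)))
    (trans (pos-+-* d q _) (cong (λ z → D +ᶻ Q *ᶻ z) (carry b s)))

  open ≡-Reasoning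
  difference : W -ᶻ + (d + q * toℕ𝔹 (b xor s)) ≡ hypDiff +ᶻ + (2 * q) *ᶻ (C -ᶻ S -ᶻ K)
  difference = begin
    W -ᶻ + (d + q * toℕ𝔹 (b xor s))
      ≡⟨ cong (W -ᶻ_) (pos-+-* d q _) ⟩
    W -ᶻ (D +ᶻ Q *ᶻ X)
      ≡⟨ identity W D Q X C S K ⟩
    ((W +ᶻ Q *ᶻ (S +ᶻ + 2 *ᶻ K)) -ᶻ (D +ᶻ Q *ᶻ ((X +ᶻ + 2 *ᶻ C) -ᶻ S)))
      +ᶻ (+ 2 *ᶻ Q) *ᶻ (C -ᶻ S -ᶻ K)
      ≡⟨ cong₂ (λ h m → h +ᶻ m *ᶻ (C -ᶻ S -ᶻ K)) hypDiff≡ (ℤ.pos-* 2 q) ⟨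
    hypDiff +ᶻ + (2 * q) *ᶻ (C -ᶻ S -ᶻ K) ∎

residues-agree : ∀ {q d w₁ w₂ x₁ x₂} .{{_ : NonZero q}} →
  w₁ ≡ d + q * toℕ𝔹 x₁ [mod 2 * q ] → w₂ ≡ d + q * toℕ𝔹 x₂ [mod 2 * q ] →
  (w₁ ≡ w₂ [mod 2 * q ]) ⇔ (x₁ ≡ x₂)
residues-agree {q} {d} {w₁} {w₂} {x₁} {x₂} w₁≡r₁ w₂≡r₂ = mk⇔
  (λ w₁≡w₂ → bit-residue-injective {q} {d}
     (≡[mod]-trans {r₁} {w₁} {r₂} {2 * q} (≡[mod]-sym {w₁} {r₁} {2 * q} w₁≡r₁)
        (≡[mod]-trans {w₁} {w₂} {r₂} {2 * q} w₁≡w₂ w₂≡r₂)))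
  (λ { refl → ≡[mod]-trans {w₁} {r₁} {w₂} {2 * q} w₁≡r₁ (≡[mod]-sym {w₂} {r₂} {2 * q} w₂≡r₂) })
  where
  r₁ r₂ : ℕ
  r₁ = d + q * toℕ𝔹 x₁
  r₂ = d + q * toℕ𝔹 x₂

module BlockDecomposition {n t} (G : Graph n) (q : ℕ) {A U : Subset n} {P B : Fin t → Subset n}
  (U⊆A : U ⊆ A)
  (disjoint : ∀ i j → i ≢ j → P i ∩ P j ≡ ⊥)
  (partition : ∀ x → (x ∈ (A ─ U)) ⇔ (∃ λ i → x ∈ P i))
  (∣P∣≡q : ∀ i → ∣ P i ∣ ≡ q)
  (trace : ∀ i x → x ∈ P i → ∀ u → (u ∈ B i) ⇔ (u ∈ U × adj G x u ≡ true))
  where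

  W : Subset t → Subset n
  W I = A ─ unionOver I P

  P⊆A─U : ∀ i → P i ⊆ A ─ U
  P⊆A─U i x∈Pᵢ = Equivalence.from (partition _) (i , x∈Pᵢ)

  unionOver⊆A : ∀ I → unionOver I P ⊆ A
  unionOver⊆A I x∈E =
    let i , _ , x∈Pᵢ = Equivalence.to (∈-unionOver {I = I} {P}) x∈E in p─q⊆p A U (P⊆A─U i x∈Pᵢ)

  unionOver⊤≡A─U : unionOver ⊤ P ≡ A ─ U
  unionOver⊤≡A─U = ⊆-antisym
    (λ x∈E → let i , _ , x∈Pᵢ = Equivalence.to (∈-unionOver {I = ⊤} {P}) x∈E in P⊆A─U i x∈Pᵢ)
    (λ {x} x∈A─U → let i , x∈Pᵢ = Equivalence.to (partition x) x∈A─U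
                   in Equivalence.from (∈-unionOver {I = ⊤} {P}) (i , ∈⊤ , x∈Pᵢ))

  A─unionOver⊤≡U : A ─ unionOver ⊤ P ≡ U
  A─unionOver⊤≡U = trans (cong (A ─_) unionOver⊤≡A─U) (p─[p─q]≡q U⊆A)

  adj≡trace : ∀ {i x u} → x ∈ P i → u ∈ U → adj G u x ≡ lookup (B i) u
  adj≡trace {i} {x} {u} x∈Pᵢ u∈U rewrite Graph.sym G u x
    with adj G x u in xu | lookup (B i) u in Bᵢu
  ... | true  | true  = refl
  ... | false | false = refl
  ... | true  | false = contradiction
    (trans (≡.sym Bᵢu) (Vec.[]=⇒lookup (Equivalence.from (trace i x x∈Pᵢ u) (u∈U , xu)))) λ ()
  ... | false | true  = contradiction
    (trans (≡.sym xu) (proj₂ (Equivalence.to (trace i x x∈Pᵢ u) (Vec.lookup⇒[]= u (B i) Bᵢu)))) λ ()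

  deg-A : ∀ I {u} → u ∈ U →
    deg G A u ≡ deg G (W I) u + q * ∑[ i < t ] toℕ𝔹 (lookup I i ∧ lookup (B i) u)
  deg-A I {u} u∈U = begin
    deg G A u
      ≡⟨ deg-split G (unionOver⊆A I) u ⟩
    deg G (W I) u + deg G (unionOver I P) u
      ≡⟨ cong (λ m → deg G (W I) u + m) (trans (deg-unionOver G disjoint I u) (sum-cong-≗ blocks)) ⟩
    deg G (W I) u + ∑[ i < t ] (q * toℕ𝔹 (lookup I i ∧ lookup (B i) u))
      ≡⟨ cong (λ m → deg G (W I) u + m) (*-distribˡ-sum q (λ i → toℕ𝔹 (lookup I i ∧ lookup (B i) u)))
       ⟨
    deg G (W I) u + q * ∑[ i < t ] toℕ𝔹 (lookup I i ∧ lookup (B i) u) ∎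
    where
    open ≡-Reasoning
    blocks : ∀ i → χ I i * deg G (P i) u ≡ q * toℕ𝔹 (lookup I i ∧ lookup (B i) u)
    blocks i = begin
      χ I i * deg G (P i) u
        ≡⟨ cong (χ I i *_) (deg-homogeneous G (∣P∣≡q i) (λ x x∈Pᵢ → adj≡trace x∈Pᵢ u∈U)) ⟩
      χ I i * (χ (B i) u * q) ≡⟨ ℕ.*-assoc (χ I i) (χ (B i) u) q ⟨
      χ I i * χ (B i) u * q   ≡⟨ ℕ.*-comm _ q ⟩
      q * (χ I i * χ (B i) u) ≡⟨ cong (q *_) (toℕ𝔹-∧ (lookup I i) (lookup (B i) u)) ⟨
      q * toℕ𝔹 (lookup I i ∧ lookup (B i) u) ∎

mainTheorem15 : ∀ {n t : ℕ} (G : Graph n) (q : ℕ) → IsPowerOfTwo q →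
    (A : Subset n) → Modular G q A →
    (d : ℕ) → (∀ v → v ∈ A → deg G A v ≡ d [mod q ]) →
    (bA : Fin n → Bool) →
    (∀ v → v ∈ A → deg G A v ≡ d + q * toℕ𝔹 (bA v) [mod 2 * q ]) →
    (U : Subset n) → U ⊆ A →
    (P : Fin t → Subset n) →
    (∀ i j → i ≢ j → P i ∩ P j ≡ ⊥) →
    (∀ x → (x ∈ (A ─ U)) ⇔ (∃ λ i → x ∈ P i)) →
    (∀ i → ∣ P i ∣ ≡ q) →
    (B : Fin t → Subset n) →
    (∀ i x → x ∈ P i → ∀ u → (u ∈ B i) ⇔ (u ∈ U × adj G x u ≡ true)) →
    (∀ (I : Subset t) →
       (∀ u v → u ∈ U → v ∈ U →
          deg G (A ─ unionOver I P) u ≡ deg G (A ─ unionOver I P) v [mod 2 * q ])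
       ⇔ EqModConst U bA (sumInd I B))
    ×
    ((∃ λ (I : Subset t) →
       ∀ u v → u ∈ U → v ∈ U →
          deg G (A ─ unionOver I P) u ≡ deg G (A ─ unionOver I P) v [mod 2 * q ])
       ⇔ InSpanModConst U bA B)
    ×
    (Modular G (2 * q) U ⇔ EqModConst U bA (sumInd ⊤ B))
mainTheorem15 G q (e , q≡2^e) A _ d _ bA bA-residue U U⊆A P disjoint partition ∣P∣≡q B trace =
  congruent⇔ ,
  mk⇔ (λ (I , h) → I , Equivalence.to (congruent⇔ I) h)
      (λ (I , c) → I , Equivalence.from (congruent⇔ I) c) ,
  subst (λ S → (∀ u v → u ∈ U → v ∈ U → deg G S u ≡ deg G S v [mod 2 * q ]) ⇔ _)
        A─unionOver⊤≡U (congruent⇔ ⊤)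
  where
  open BlockDecomposition G q U⊆A disjoint partition ∣P∣≡q trace

  instance
    q≢0 : NonZero q
    q≢0 = subst NonZero (≡.sym q≡2^e) (ℕ.m^n≢0 2 e)

  residue : ∀ I {u} → u ∈ U → deg G (W I) u ≡ d + q * toℕ𝔹 (bA u xor sumInd I B u) [mod 2 * q ]
  residue I {u} u∈U =
    let k , ∑≡ = sumInd-parity I B u
    in residue-xor {q} {d} {deg G (W I) u} {bA u} {sumInd I B u} k
         (subst (λ a → a ≡ d + q * toℕ𝔹 (bA u) [mod 2 * q ])
                (trans (deg-A I u∈U) (cong (λ s → deg G (W I) u + q * s) ∑≡))
                (bA-residue u (U⊆A u∈U)))

  congruent⇔ : ∀ I → (∀ u v → u ∈ U → v ∈ U → deg G (W I) u ≡ deg G (W I) v [mod 2 * q ])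
                     ⇔ EqModConst U bA (sumInd I B)
  congruent⇔ I = pairwise⇔constantOn U λ {u} {v} u∈U v∈U →
    residues-agree {q} {d} {deg G (W I) u} {deg G (W I) v} (residue I u∈U) (residue I v∈U)
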